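{- Let $P$ be a logic program and $\Delta$ be a filter that is DN for $P$. Let $A$, $B_1$, $B_2$ be atoms and $\mathbf B_1$, $\mathbf B_2$ be queries. If $A\Rightarrow^*_P B_1,\mathbf B_1$ and $B_1\Rightarrow^+_P B_2,\mathbf B_2$ (via left derivation steps) and $B_2$ is $\Delta$-more general than $B_1$, then $P\cup\{A\}$ left loops, i.e. there exists an infinite left derivation of $P\cup\{A\}$.
   Context: Fix a first-order language $\mathcal L$; $\Pi$ is its set of relation symbols, each $p$ with unique arity $arity(p)$; $TU_{\mathcal L}$ is the set of all terms. A query is a finite sequence of atoms; a logic program is a finite set of definite clauses. SLD-derivation step: given a query $\mathbf A,B,\mathbf C$ and a clause $c$, take a variant $H\leftarrow\mathbf B$ of $c$ variable disjoint from the query with $B,H$ unifiable and mgu $\theta$; then $\mathbf A,B,\mathbf C\Rightarrow_c^\theta(\mathbf A,\mathbf B,\mathbf C)\theta$ (selected atom $B$). An SLD-derivation of $P\cup\{Q_0\}$ is a maximal sequence of such steps from $Q_0$ using clauses of $P$ with standardization apart (each input clause variable disjoint from $Q_0$ and from earlier mgus and input clauses). A left derivation step is an SLD-derivation step whose selected atom is the leftmost atom of the query; a left derivation uses only left derivation steps. $Q\Rightarrow^*_PQ'$ (resp. $Q\Rightarrow^+_PQ'$) means there is a finite (resp. finite non-empty) prefix ending at $Q'$ of a left derivation of $P\cup\{Q\}$. A term-condition is a map $TU_{\mathcal L}\to\{\mathtt{true},\mathtt{false}\}$. A filter $\Delta$ assigns to each $p\in\Pi$ a partial function $\Delta(p)$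 from $\{1,\dots,arity(p)\}$ to term-conditions. For a substitution $\eta$, an atom $A=p(s_1,\dots,s_n)$ is $\Delta$-more general than $B$ for $\eta$ if $B=p(t_1,\dots,t_n)$, $t_i=s_i\eta$ for $i\notin Dom(\Delta(p))$, and $\Delta(p)(i)(s_i)=\mathtt{true}$ for $i\in Dom(\Delta(p))$; a query $A_1,\dots,A_n$ is $\Delta$-more general than $B_1,\dots,B_m$ for $\eta$ if $n=m$ and componentwise for the same $\eta$; "$\Delta$-more general" means for some $\eta$. A step $Q'\Rightarrow_cQ'_1$ is a $\Delta$-lift of a step $Q\Rightarrow_cQ_1$ if $Q'$ is $\Delta$-more general than $Q$, $Q'_1$ is $\Delta$-more general than $Q_1$, and atoms in the same positions are selected in $Q$ and $Q'$. $\Delta$ is DN for a clause $c$ if for every SLD-derivation step $Q\Rightarrow_cQ_1$ and every query $Q'$ $\Delta$-more general than $Q$ there is $Q'_1$ with $Q'\Rightarrow_cQ'_1$ a $\Delta$-lift of $Q\Rightarrow_cQ_1$; DN for $P$ if DN for each clause of $P$. -}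

module Defs where

open import Data.Nat using (ℕ; zero; suc; _<_; _≤_)
open import Data.Fin using (Fin)
open import Data.Vec using (Vec; []; _∷_; lookup)
open import Data.List using (List; []; _∷_; _++_; map; length)
open import Data.List.Relation.Unary.Any using (Any)
open import Data.List.Relation.Binary.Pointwise using (Pointwise)
open import Data.List.Membership.Propositional using (_∈_)
open import Data.Bool using (Bool; true)
open import Data.Maybe using (Maybe; just; nothing)
open import Data.Product using (Σ; ∃; _×_; _,_)
open import Data.Sum using (_⊎_)
open import Relation.Binary.PropositionalEquality using (_≡_; _≢_)
open import Relation.Nullary using (¬_)

-- A first-order language: function symbols (constants = arity 0) and
-- relation symbols Π, each with a unique arity.  Variables are ℕ.
record Language : Set₁ where
  field
    Fun    : Set
    farity : Fun → ℕ
    Π      : Set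
    arity  : Π → ℕ

module Lang (L : Language) where
  open Language L

  data Term : Set where
    var : ℕ → Term
    fun : (f : Fun) → Vec Term (farity f) → Term

  data Atom : Set where
    atom : (p : Π) → Vec Term (arity p) → Atom

  Query : Set
  Query = List Atom

  record Clause : Set where
    constructor _⇐_
    field
      head : Atom
      body : Query
  open Clause public

  Program : Set
  Program = List Clause

  Subst : Set
  Subst = ℕ → Term

  mutual
    _⟨_⟩ : Term → Subst → Term
    var x ⟨ σ ⟩ = σ x
    fun f ts ⟨ σ ⟩ = fun f (ts ⟨ σ ⟩s)

    _⟨_⟩s : ∀ {n} → Vec Term n → Subst → Vec Term n
    [] ⟨ σ ⟩s = []
    (t ∷ ts) ⟨ σ ⟩s = (t ⟨ σ ⟩) ∷ (ts ⟨ σ ⟩s)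

  _⟨_⟩a : Atom → Subst → Atom
  atom p ts ⟨ σ ⟩a = atom p (ts ⟨ σ ⟩s)

  _⟨_⟩q : Query → Subst → Query
  Q ⟨ σ ⟩q = map (_⟨ σ ⟩a) Q

  _⟨_⟩c : Clause → Subst → Clause
  (H ⇐ B) ⟨ σ ⟩c = (H ⟨ σ ⟩a) ⇐ (B ⟨ σ ⟩q)

  mutual
    data _∈vT_ (x : ℕ) : Term → Set where
      here : x ∈vT var x
      args : ∀ {f ts} → x ∈vTs ts → x ∈vT fun f ts

    data _∈vTs_ (x : ℕ) : ∀ {n} → Vec Term n → Set where
      hd : ∀ {n t} {ts : Vec Term n} → x ∈vT t → x ∈vTs (t ∷ ts)
      tl : ∀ {n t} {ts : Vec Term n} → x ∈vTs ts → x ∈vTs (t ∷ ts)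

  data _∈vA_ (x : ℕ) : Atom → Set where
    inAtom : ∀ {p ts} → x ∈vTs ts → x ∈vA atom p ts

  _∈vQ_ : ℕ → Query → Set
  x ∈vQ Q = Any (x ∈vA_) Q

  _∈vC_ : ℕ → Clause → Set
  x ∈vC c = x ∈vA head c ⊎ x ∈vQ body c

  -- Var(θ) = Dom(θ) ∪ Ran(θ)
  _∈vS_ : ℕ → Subst → Set
  x ∈vS θ = (θ x ≢ var x) ⊎ (Σ ℕ λ y → (θ y ≢ var y) × x ∈vT θ y)

  Variant : Clause → Clause → Set
  Variant c' c = (Σ Subst λ ρ → c' ≡ c ⟨ ρ ⟩c) × (Σ Subst λ ρ' → c ≡ c' ⟨ ρ' ⟩c)

  MGU : Subst → Atom → Atom → Set
  MGU θ A B = (A ⟨ θ ⟩a ≡ B ⟨ θ ⟩a)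
            × (∀ σ → A ⟨ σ ⟩a ≡ B ⟨ σ ⟩a → Σ Subst λ δ → ∀ x → σ x ≡ (θ x) ⟨ δ ⟩)

  -- An SLD-derivation step  Q ⇒_c^θ Q1  using the variant c' of c.
  -- The selected atom is  sel  at position  length pre .
  record StepVia (c c' : Clause) (θ : Subst) (Q Q1 : Query) : Set where
    field
      pre       : Query
      sel       : Atom
      post      : Query
      split     : Q ≡ pre ++ (sel ∷ post)
      isVariant : Variant c' c
      disjoint  : ∀ x → x ∈vC c' → ¬ (x ∈vQ Q)
      isMGU     : MGU θ sel (head c')
      result    : Q1 ≡ (pre ++ body c' ++ post) ⟨ θ ⟩q

  SLDStep : Clause → Query → Query → Set
  SLDStep c Q Q1 = Σ Clause λ c' → Σ Subst λ θ → StepVia c c' θ Q Q1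

  LeftStepVia : Clause → Clause → Subst → Query → Query → Set
  LeftStepVia c c' θ Q Q1 = Σ (StepVia c c' θ Q Q1) λ st → StepVia.pre st ≡ []

  StdApart : Query → (ℕ → Clause) → (ℕ → Subst) → ℕ → Set
  StdApart Q0 vs θs i =
    ∀ x → x ∈vC vs i →
      ¬ (x ∈vQ Q0) × (∀ j → j < i → ¬ (x ∈vC vs j) × ¬ (x ∈vS θs j))

  record LeftPrefix (P : Program) (Q Q' : Query) (n : ℕ) : Set where
    field
      qs     : ℕ → Query
      cls    : ℕ → Clause
      vs     : ℕ → Clause
      θs     : ℕ → Subst
      start  : qs 0 ≡ Q
      finish : qs n ≡ Q'
      inP    : ∀ i → i < n → cls i ∈ P
      step   : ∀ i → i < n → LeftStepVia (cls i) (vs i) (θs i) (qs i) (qs (suc i))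
      apart  : ∀ i → i < n → StdApart Q vs θs i

  _⇒*[_]_ : Query → Program → Query → Set
  Q ⇒*[ P ] Q' = Σ ℕ λ n → LeftPrefix P Q Q' n

  _⇒+[_]_ : Query → Program → Query → Set
  Q ⇒+[ P ] Q' = Σ ℕ λ n → (1 ≤ n) × LeftPrefix P Q Q' n

  record InfiniteLeftDerivation (P : Program) (Q : Query) : Set where
    field
      qs     : ℕ → Query
      cls    : ℕ → Clause
      vs     : ℕ → Clause
      θs     : ℕ → Subst
      start  : qs 0 ≡ Q
      inP    : ∀ i → cls i ∈ P
      step   : ∀ i → LeftStepVia (cls i) (vs i) (θs i) (qs i) (qs (suc i))
      apart  : ∀ i → StdApart Q vs θs i

  LeftLoops : Program → Query → Set
  LeftLoops P Q = InfiniteLeftDerivation P Q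

  TermCondition : Set
  TermCondition = Term → Bool

  Filter : Set
  Filter = (p : Π) → Fin (arity p) → Maybe TermCondition

  ArgCond : Maybe TermCondition → Term → Term → Subst → Set
  ArgCond nothing  s t η = t ≡ s ⟨ η ⟩
  ArgCond (just φ) s t η = φ s ≡ true

  data MoreGenAtomFor (Δ : Filter) (η : Subst) : Atom → Atom → Set where
    mg : ∀ {p} {s t : Vec Term (arity p)} →
         (∀ i → ArgCond (Δ p i) (lookup s i) (lookup t i) η) →
         MoreGenAtomFor Δ η (atom p s) (atom p t)

  MoreGenQueryFor : Filter → Subst → Query → Query → Set
  MoreGenQueryFor Δ η = Pointwise (MoreGenAtomFor Δ η)

  MoreGenAtom : Filter → Atom → Atom → Set
  MoreGenAtom Δ A B = Σ Subst λ η → MoreGenAtomFor Δ η A B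

  MoreGenQuery : Filter → Query → Query → Set
  MoreGenQuery Δ Q Q' = Σ Subst λ η → MoreGenQueryFor Δ η Q Q'

  DNClause : Filter → Clause → Set
  DNClause Δ c =
    ∀ c' θ Q Q1 (st : StepVia c c' θ Q Q1) Q' → MoreGenQuery Δ Q' Q →
      Σ Query λ Q'1 → Σ Clause λ c'' → Σ Subst λ θ' →
        Σ (StepVia c c'' θ' Q' Q'1) λ st' →
          (length (StepVia.pre st') ≡ length (StepVia.pre st))
          × MoreGenQuery Δ Q'1 Q1

  DN : Filter → Program → Set
  DN Δ P = ∀ c → c ∈ P → DNClause Δ c

module Submission where

-- Lifting the cycle B₁ ⇒⁺ B₂,𝐁₂ through the DN property, starting from "B₂ is Δ-more general than
-- B₁", gives B₂ ⇒⁺ B₃,𝐁₃ with B₃ Δ-more general than B₂, and so on; since left steps never select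
-- the tails 𝐁ᵢ, these cycles chain into an infinite sequence of left steps from A.
-- The work lies in standardization apart, which also forbids later clause variables to occur in
-- Var(θ) of an earlier mgu θ, while an arbitrary mgu may move infinitely many variables. So every
-- step is normalised before it is taken: its clause variant is renamed into fresh even variables
-- above the current bound N, and its mgu is replaced by one that agrees with it on the finitely many
-- variables of the query and the variant and sends all other variables injectively into odd
-- variables beyond a new bound N′, fixing the even ones (Hilbert's hotel). This is still an mgu,
-- and its Var contains no even variable ≥ N′, which is where all later variants live. It renames
-- the unselected tail of the query, which does not matter.

open import Data.Nat
open import Data.Nat.Properties
open import Data.Vec using (Vec; []; _∷_)
open import Data.List using ([]; _∷_; _++_; length)
open import Data.List.Properties using (map-∘; map-cong; map-++; ++-assoc)
open import Data.List.Membership.Propositional using (_∈_)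
open import Data.List.Relation.Unary.Any using (here; there; any?)
open import Data.List.Relation.Unary.Any.Properties using (++⁺ˡ; ++⁺ʳ; ++⁻)
open import Data.List.Relation.Binary.Pointwise using (_∷_; [])
open import Data.Product using (Σ; ∃; _×_; _,_; proj₁; proj₂)
open import Data.Sum using (_⊎_; inj₁; inj₂; [_,_]′; map₁)
open import Function using (_∘_; id; case_of_)
open import Level using (0ℓ)
open import Relation.Nullary using (¬_; Dec; yes; no; contradiction)
open import Relation.Nullary.Decidable using (_×-dec_; _⊎-dec_; map′)
open import Relation.Unary using (Pred; _⊆_; _∪_; Decidable)
open import Relation.Binary.PropositionalEquality
open import Relation.Binary.Construct.Closure.Transitive using (TransClosure; [_]; _∷_)
open import Algebra.Definitions (_≡_ {A = ℕ}) using (Involutive)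

open import Defs

Even : ℕ → Set
Even n = ∃ λ w → n ≡ 2 * w

Odd : ℕ → Set
Odd n = ∃ λ w → n ≡ suc (2 * w)

even⊎odd : ∀ n → Even n ⊎ Odd n
even⊎odd zero = inj₁ (0 , refl)
even⊎odd (suc n) with even⊎odd n
... | inj₁ (w , n≡2w) = inj₂ (w , cong suc n≡2w)
... | inj₂ (w , n≡1+2w) = inj₁ (suc w , trans (cong suc n≡1+2w) (sym (*-suc 2 w)))

even? : ∀ n → Dec (Even n)
even? n with even⊎odd n
... | inj₁ e = yes e
... | inj₂ (w , n≡1+2w) = no λ (v , n≡2v) → even≢odd v w (trans (sym n≡2v) n≡1+2w)

2*-injective : ∀ {m n} → 2 * m ≡ 2 * n → m ≡ n
2*-injective {m} {n} = *-cancelˡ-≡ m n 2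

VarsBelow : ℕ → Pred ℕ 0ℓ → Set
VarsBelow N X = ∀ x → X x → x < N

Bounded : Pred ℕ 0ℓ → Set
Bounded X = ∃ λ N → VarsBelow N X

bounded-∪ : ∀ {X Y Z} → Bounded X → Bounded Y → Z ⊆ X ∪ Y → Bounded Z
bounded-∪ (M , X<M) (N , Y<N) Z⊆X∪Y = M ⊔ N , λ x x∈Z → case Z⊆X∪Y x∈Z of λ
  { (inj₁ x∈X) → ≤-trans (X<M x x∈X) (m≤m⊔n M N)
  ; (inj₂ x∈Y) → ≤-trans (Y<N x x∈Y) (m≤n⊔m M N) }

bounded-⊆ : ∀ {X Y} → Y ⊆ X → Bounded X → Bounded Y
bounded-⊆ Y⊆X (N , X<N) = N , λ x x∈Y → X<N x (Y⊆X x∈Y)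

module HilbertHotel (K : ℕ) where

  move : ℕ → ℕ
  move y with even? y ×-dec K ≤? y
  ... | yes _ = y
  ... | no _ = suc (2 * (y + K))

  move⁻¹ : ℕ → ℕ
  move⁻¹ z with even⊎odd z
  ... | inj₁ _ = z
  ... | inj₂ (m , _) with K ≤? m
  ...   | yes _ = m ∸ K
  ...   | no _ = z

  move⁻¹-even : ∀ {z} → Even z → move⁻¹ z ≡ z
  move⁻¹-even {z} (v , z≡2v) with even⊎odd z
  ... | inj₁ _ = refl
  ... | inj₂ (w , z≡1+2w) = contradiction (trans (sym z≡2v) z≡1+2w) (even≢odd v w)

  move⁻¹-odd : ∀ m → K ≤ m → move⁻¹ (suc (2 * m)) ≡ m ∸ K
  move⁻¹-odd m K≤m with even⊎odd (suc (2 * m))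
  ... | inj₁ (v , e) = contradiction (sym e) (even≢odd v m)
  ... | inj₂ (w , e) with 2*-injective {m} {w} (suc-injective e)
  ...   | refl with K ≤? w
  ...     | yes _ = refl
  ...     | no K≰w = contradiction K≤m K≰w

  move⁻¹-move : ∀ y → move⁻¹ (move y) ≡ y
  move⁻¹-move y with even? y ×-dec K ≤? y
  ... | yes (even-y , _) = move⁻¹-even even-y
  ... | no _ = trans (move⁻¹-odd (y + K) (m≤n+m K y)) (m+n∸n≡m y K)

  K≤move : ∀ y → K ≤ move y
  K≤move y with even? y ×-dec K ≤? y
  ... | yes (_ , K≤y) = K≤y
  ... | no _ = m≤n⇒m≤1+n (≤-trans (m≤n+m K y) (m≤n*m (y + K) 2))

  move-even : ∀ {x} → Even x → K ≤ x → move x ≡ x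
  move-even {x} even-x K≤x with even? x ×-dec K ≤? x
  ... | yes _ = refl
  ... | no ¬both = contradiction (even-x , K≤x) ¬both

module FreshSwap {V : Pred ℕ 0ℓ} (V? : Decidable V) (S : ℕ) (V<S : VarsBelow S V) where

  fresh : ℕ → ℕ
  fresh y = 2 * (y + S)

  S≤fresh : ∀ y → S ≤ fresh y
  S≤fresh y = ≤-trans (m≤n+m S y) (m≤n*m (y + S) 2)

  fresh-injective : ∀ {y z} → fresh y ≡ fresh z → y ≡ z
  fresh-injective {y} {z} = +-cancelʳ-≡ S y z ∘ 2*-injective

  FreshImage : Pred ℕ 0ℓ
  FreshImage y = ∃ λ z → V z × y ≡ fresh z

  fresh-image? : Decidable FreshImage
  fresh-image? y with even⊎odd y
  ... | inj₂ (w , y≡1+2w) = no λ (z , _ , y≡fz) → even≢odd (z + S) w (trans (sym y≡fz) y≡1+2w)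
  ... | inj₁ (w , y≡2w) with S ≤? w
  ...   | no S≰w = no λ (z , _ , y≡fz) →
          S≰w (subst (S ≤_) (2*-injective (trans (sym y≡fz) y≡2w)) (m≤n+m S z))
  ...   | yes S≤w with V? (w ∸ S)
  ...     | yes v = yes (w ∸ S , v , trans y≡2w (cong (2 *_) (sym (m∸n+n≡m S≤w))))
  ...     | no ¬v = no λ (z , v , y≡fz) →
            ¬v (subst V (sym (trans (cong (_∸ S) (2*-injective (trans (sym y≡2w) y≡fz))) (m+n∸n≡m z S))) v)

  swap : ℕ → ℕ
  swap y with V? y | fresh-image? y
  ... | yes _ | _ = fresh y
  ... | no _ | yes (z , _) = z
  ... | no _ | no _ = y

  swap-V : ∀ {y} → V y → swap y ≡ fresh y
  swap-V {y} v with V? y | fresh-image? y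
  ... | yes _ | _ = refl
  ... | no ¬v | _ = contradiction v ¬v

  swap-fresh : ∀ {z} → V z → swap (fresh z) ≡ z
  swap-fresh {z} v with V? (fresh z) | fresh-image? (fresh z)
  ... | yes v′ | _ = contradiction (S≤fresh z) (<⇒≱ (V<S (fresh z) v′))
  ... | no _ | yes (z′ , _ , fz≡fz′) = sym (fresh-injective fz≡fz′)
  ... | no _ | no ¬image = contradiction (z , v , refl) ¬image

  swap-outside : ∀ {y} → ¬ V y → ¬ FreshImage y → swap y ≡ y
  swap-outside {y} ¬v ¬image with V? y | fresh-image? y
  ... | yes v | _ = contradiction v ¬v
  ... | no _ | yes image = contradiction image ¬image
  ... | no _ | no _ = refl

  swap-below : ∀ {y} → y < S → ¬ V y → swap y ≡ y
  swap-below y<S ¬v = swap-outside ¬v λ (z , _ , y≡fz) → <⇒≱ y<S (subst (S ≤_) (sym y≡fz) (S≤fresh z))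

  swap-involutive : ∀ y → swap (swap y) ≡ y
  swap-involutive y = cases (V? y) (fresh-image? y)
    where
      cases : Dec (V y) → Dec (FreshImage y) → swap (swap y) ≡ y
      cases (yes v) _ = trans (cong swap (swap-V v)) (swap-fresh v)
      cases (no _) (yes (z , v , y≡fz)) =
        subst (λ y → swap (swap y) ≡ y) (sym y≡fz) (trans (cong swap (swap-fresh v)) (swap-V v))
      cases (no ¬v) (no ¬image) = trans (cong swap (swap-outside ¬v ¬image)) (swap-outside ¬v ¬image)

module Substitution (L : Language) where
  open Language L
  open Lang L

  _⨾_ : Subst → Subst → Subst
  (σ ⨾ δ) x = σ x ⟨ δ ⟩

  mutual
    ⟨⟩-⨾ : ∀ t σ δ → t ⟨ σ ⟩ ⟨ δ ⟩ ≡ t ⟨ σ ⨾ δ ⟩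
    ⟨⟩-⨾ (var x) σ δ = refl
    ⟨⟩-⨾ (fun f ts) σ δ = cong (fun f) (⟨⟩s-⨾ ts σ δ)

    ⟨⟩s-⨾ : ∀ {n} (ts : Vec Term n) σ δ → ts ⟨ σ ⟩s ⟨ δ ⟩s ≡ ts ⟨ σ ⨾ δ ⟩s
    ⟨⟩s-⨾ [] σ δ = refl
    ⟨⟩s-⨾ (t ∷ ts) σ δ = cong₂ _∷_ (⟨⟩-⨾ t σ δ) (⟨⟩s-⨾ ts σ δ)

  ⟨⟩a-⨾ : ∀ A σ δ → A ⟨ σ ⟩a ⟨ δ ⟩a ≡ A ⟨ σ ⨾ δ ⟩a
  ⟨⟩a-⨾ (atom p ts) σ δ = cong (atom p) (⟨⟩s-⨾ ts σ δ)

  ⟨⟩q-⨾ : ∀ Q σ δ → Q ⟨ σ ⟩q ⟨ δ ⟩q ≡ Q ⟨ σ ⨾ δ ⟩q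
  ⟨⟩q-⨾ Q σ δ = trans (sym (map-∘ Q)) (map-cong (λ A → ⟨⟩a-⨾ A σ δ) Q)

  ⟨⟩c-⨾ : ∀ c σ δ → c ⟨ σ ⟩c ⟨ δ ⟩c ≡ c ⟨ σ ⨾ δ ⟩c
  ⟨⟩c-⨾ (H ⇐ B) σ δ = cong₂ _⇐_ (⟨⟩a-⨾ H σ δ) (⟨⟩q-⨾ B σ δ)

  mutual
    ⟨⟩-local : ∀ t {σ δ} → (∀ x → x ∈vT t → σ x ≡ δ x) → t ⟨ σ ⟩ ≡ t ⟨ δ ⟩
    ⟨⟩-local (var x) σ≡δ = σ≡δ x here
    ⟨⟩-local (fun f ts) σ≡δ = cong (fun f) (⟨⟩s-local ts (λ x → σ≡δ x ∘ args))

    ⟨⟩s-local : ∀ {n} (ts : Vec Term n) {σ δ} → (∀ x → x ∈vTs ts → σ x ≡ δ x) → ts ⟨ σ ⟩s ≡ ts ⟨ δ ⟩s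
    ⟨⟩s-local [] σ≡δ = refl
    ⟨⟩s-local (t ∷ ts) σ≡δ = cong₂ _∷_ (⟨⟩-local t (λ x → σ≡δ x ∘ hd)) (⟨⟩s-local ts (λ x → σ≡δ x ∘ tl))

  ⟨⟩a-local : ∀ A {σ δ} → (∀ x → x ∈vA A → σ x ≡ δ x) → A ⟨ σ ⟩a ≡ A ⟨ δ ⟩a
  ⟨⟩a-local (atom p ts) σ≡δ = cong (atom p) (⟨⟩s-local ts (λ x → σ≡δ x ∘ inAtom))

  ⟨⟩q-local : ∀ Q {σ δ} → (∀ x → x ∈vQ Q → σ x ≡ δ x) → Q ⟨ σ ⟩q ≡ Q ⟨ δ ⟩q
  ⟨⟩q-local [] σ≡δ = refl
  ⟨⟩q-local (A ∷ Q) σ≡δ = cong₂ _∷_ (⟨⟩a-local A (λ x → σ≡δ x ∘ here)) (⟨⟩q-local Q (λ x → σ≡δ x ∘ there))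

  ⟨⟩c-local : ∀ c {σ δ} → (∀ x → x ∈vC c → σ x ≡ δ x) → c ⟨ σ ⟩c ≡ c ⟨ δ ⟩c
  ⟨⟩c-local (H ⇐ B) σ≡δ = cong₂ _⇐_ (⟨⟩a-local H (λ x → σ≡δ x ∘ inj₁)) (⟨⟩q-local B (λ x → σ≡δ x ∘ inj₂))

  mutual
    ∈vT-⟨⟩⁻ : ∀ t σ {x} → x ∈vT (t ⟨ σ ⟩) → ∃ λ y → y ∈vT t × x ∈vT σ y
    ∈vT-⟨⟩⁻ (var y) σ x∈ = y , here , x∈
    ∈vT-⟨⟩⁻ (fun f ts) σ (args x∈) with ∈vTs-⟨⟩⁻ ts σ x∈
    ... | y , y∈ , x∈σy = y , args y∈ , x∈σy

    ∈vTs-⟨⟩⁻ : ∀ {n} (ts : Vec Term n) σ {x} → x ∈vTs (ts ⟨ σ ⟩s) → ∃ λ y → y ∈vTs ts × x ∈vT σ y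
    ∈vTs-⟨⟩⁻ (t ∷ ts) σ (hd x∈) with ∈vT-⟨⟩⁻ t σ x∈
    ... | y , y∈ , x∈σy = y , hd y∈ , x∈σy
    ∈vTs-⟨⟩⁻ (t ∷ ts) σ (tl x∈) with ∈vTs-⟨⟩⁻ ts σ x∈
    ... | y , y∈ , x∈σy = y , tl y∈ , x∈σy

  ∈vA-⟨⟩⁻ : ∀ A σ {x} → x ∈vA (A ⟨ σ ⟩a) → ∃ λ y → y ∈vA A × x ∈vT σ y
  ∈vA-⟨⟩⁻ (atom p ts) σ (inAtom x∈) with ∈vTs-⟨⟩⁻ ts σ x∈
  ... | y , y∈ , x∈σy = y , inAtom y∈ , x∈σy

  ∈vQ-⟨⟩⁻ : ∀ Q σ {x} → x ∈vQ (Q ⟨ σ ⟩q) → ∃ λ y → y ∈vQ Q × x ∈vT σ y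
  ∈vQ-⟨⟩⁻ (A ∷ Q) σ (here x∈) with ∈vA-⟨⟩⁻ A σ x∈
  ... | y , y∈ , x∈σy = y , here y∈ , x∈σy
  ∈vQ-⟨⟩⁻ (A ∷ Q) σ (there x∈) with ∈vQ-⟨⟩⁻ Q σ x∈
  ... | y , y∈ , x∈σy = y , there y∈ , x∈σy

  ∈vC-⟨⟩⁻ : ∀ c σ {x} → x ∈vC (c ⟨ σ ⟩c) → ∃ λ y → y ∈vC c × x ∈vT σ y
  ∈vC-⟨⟩⁻ (H ⇐ B) σ (inj₁ x∈) with ∈vA-⟨⟩⁻ H σ x∈
  ... | y , y∈ , x∈σy = y , inj₁ y∈ , x∈σy
  ∈vC-⟨⟩⁻ (H ⇐ B) σ (inj₂ x∈) with ∈vQ-⟨⟩⁻ B σ x∈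
  ... | y , y∈ , x∈σy = y , inj₂ y∈ , x∈σy

  mutual
    _∈vT?_ : ∀ x t → Dec (x ∈vT t)
    x ∈vT? var y with x ≟ y
    ... | yes refl = yes here
    ... | no x≢y = no λ { here → x≢y refl }
    x ∈vT? fun f ts = map′ args (λ { (args x∈) → x∈ }) (x ∈vTs? ts)

    _∈vTs?_ : ∀ x {n} (ts : Vec Term n) → Dec (x ∈vTs ts)
    x ∈vTs? [] = no λ ()
    x ∈vTs? (t ∷ ts) = map′ [ hd , tl ]′ (λ { (hd x∈) → inj₁ x∈ ; (tl x∈) → inj₂ x∈ })
                             ((x ∈vT? t) ⊎-dec (x ∈vTs? ts))

  _∈vA?_ : ∀ x A → Dec (x ∈vA A)
  x ∈vA? atom p ts = map′ inAtom (λ { (inAtom x∈) → x∈ }) (x ∈vTs? ts)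

  _∈vC?_ : ∀ x c → Dec (x ∈vC c)
  x ∈vC? (H ⇐ B) = (x ∈vA? H) ⊎-dec any? (x ∈vA?_) B

  mutual
    boundedT : ∀ t → Bounded (_∈vT t)
    boundedT (var y) = suc y , λ { .y here → ≤-refl }
    boundedT (fun f ts) = bounded-⊆ (λ { (args x∈) → x∈ }) (boundedTs ts)

    boundedTs : ∀ {n} (ts : Vec Term n) → Bounded (_∈vTs ts)
    boundedTs [] = 0 , λ _ ()
    boundedTs (t ∷ ts) = bounded-∪ (boundedT t) (boundedTs ts) λ { (hd x∈) → inj₁ x∈ ; (tl x∈) → inj₂ x∈ }

  boundedA : ∀ A → Bounded (_∈vA A)
  boundedA (atom p ts) = bounded-⊆ (λ { (inAtom x∈) → x∈ }) (boundedTs ts)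

  boundedQ : ∀ Q → Bounded (_∈vQ Q)
  boundedQ [] = 0 , λ _ ()
  boundedQ (A ∷ Q) = bounded-∪ (boundedA A) (boundedQ Q) λ { (here x∈) → inj₁ x∈ ; (there x∈) → inj₂ x∈ }

  boundedC : ∀ c → Bounded (_∈vC c)
  boundedC (H ⇐ B) = bounded-∪ (boundedA H) (boundedQ B) id

  bounded-range : ∀ (σ : Subst) B → Bounded (λ x → ∃ λ y → y < B × x ∈vT σ y)
  bounded-range σ zero = 0 , λ { x (y , () , _) }
  bounded-range σ (suc B) = bounded-∪ (bounded-range σ B) (boundedT (σ B)) λ {x} (y , y<1+B , x∈σy) →
    case m≤n⇒m<n∨m≡n (s≤s⁻¹ y<1+B) of λ
      { (inj₁ y<B) → inj₁ (y , y<B , x∈σy)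
      ; (inj₂ refl) → inj₂ x∈σy }

  ∈vT-var : ∀ {x y} → x ∈vT var y → x ≡ y
  ∈vT-var here = refl

  patch : ℕ → Subst → Subst → Subst
  patch B σ δ y with y <? B
  ... | yes _ = σ y
  ... | no _ = δ y

  patch-< : ∀ {B σ δ y} → y < B → patch B σ δ y ≡ σ y
  patch-< {B} {y = y} y<B with y <? B
  ... | yes _ = refl
  ... | no y≮B = contradiction y<B y≮B

  patch-≥ : ∀ {B σ δ y} → B ≤ y → patch B σ δ y ≡ δ y
  patch-≥ {B} {y = y} B≤y with y <? B
  ... | yes y<B = contradiction B≤y (<⇒≱ y<B)
  ... | no _ = refl

  ⟨⟩q-++₃ : ∀ Q R S σ → (Q ++ R ++ S) ⟨ σ ⟩q ≡ Q ⟨ σ ⟩q ++ R ⟨ σ ⟩q ++ S ⟨ σ ⟩q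
  ⟨⟩q-++₃ Q R S σ = trans (map-++ _ Q (R ++ S)) (cong (Q ⟨ σ ⟩q ++_) (map-++ _ R S))

module Resolution (L : Language) where
  open Language L
  open Lang L
  open Substitution L

  resolvent-vars : ∀ pre {A} c post {x} → x ∈vQ (pre ++ body c ++ post) → x ∈vQ (pre ++ A ∷ post) ⊎ x ∈vC c
  resolvent-vars pre c post x∈ with ++⁻ pre x∈
  ... | inj₁ x∈pre = inj₁ (++⁺ˡ x∈pre)
  ... | inj₂ x∈rest with ++⁻ (body c) x∈rest
  ...   | inj₁ x∈body = inj₂ (inj₂ x∈body)
  ...   | inj₂ x∈post = inj₁ (++⁺ʳ pre (there x∈post))

  StepVia-resolvent-vars : ∀ {c c′ θ Q Q₁ x} (st : StepVia c c′ θ Q Q₁) →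
                           let open StepVia st in x ∈vQ (pre ++ body c′ ++ post) → x ∈vQ Q ⊎ x ∈vC c′
  StepVia-resolvent-vars {c′ = c′} {x = x} st = map₁ (subst (x ∈vQ_) (sym split)) ∘ resolvent-vars pre c′ post
    where open StepVia st

  StepVia-result-vars : ∀ {c c′ θ Q Q₁ x} (st : StepVia c c′ θ Q Q₁) → x ∈vQ Q₁ →
                        ∃ λ y → (y ∈vQ Q ⊎ y ∈vC c′) × x ∈vT θ y
  StepVia-result-vars {c′ = c′} {θ} {x = x} st x∈Q₁ =
    let y , y∈ , x∈θy = ∈vQ-⟨⟩⁻ (pre ++ body c′ ++ post) θ (subst (x ∈vQ_) result x∈Q₁)
    in y , StepVia-resolvent-vars st y∈ , x∈θy
    where open StepVia st

  rename : (ℕ → ℕ) → Subst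
  rename π = var ∘ π

  MGU-rename : ∀ {θ A H} π → Involutive π → (∀ y → y ∈vA A → π y ≡ y) →
               MGU θ A H → MGU (θ ∘ π) A (H ⟨ rename π ⟩a)
  MGU-rename {θ} {A} {H} π π-inv π-fixes-A (unifies , most-general) = unifies′ , most-general′
    where
      A-fixed : ∀ σ → A ⟨ σ ∘ π ⟩a ≡ A ⟨ σ ⟩a
      A-fixed σ = ⟨⟩a-local A (λ y y∈A → cong σ (π-fixes-A y y∈A))

      unifies′ : A ⟨ θ ∘ π ⟩a ≡ H ⟨ rename π ⟩a ⟨ θ ∘ π ⟩a
      unifies′ = begin
        A ⟨ θ ∘ π ⟩a                 ≡⟨ A-fixed θ ⟩
        A ⟨ θ ⟩a                     ≡⟨ unifies ⟩
        H ⟨ θ ⟩a                     ≡⟨ ⟨⟩a-local H (λ y _ → cong θ (sym (π-inv y))) ⟩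
        H ⟨ θ ∘ π ∘ π ⟩a             ≡⟨ sym (⟨⟩a-⨾ H (rename π) (θ ∘ π)) ⟩
        H ⟨ rename π ⟩a ⟨ θ ∘ π ⟩a   ∎
        where open ≡-Reasoning

      most-general′ : ∀ σ → A ⟨ σ ⟩a ≡ H ⟨ rename π ⟩a ⟨ σ ⟩a → ∃ λ δ → ∀ x → σ x ≡ θ (π x) ⟨ δ ⟩
      most-general′ σ σ-unifies
        with most-general (σ ∘ π) (trans (A-fixed σ) (trans σ-unifies (⟨⟩a-⨾ H (rename π) σ)))
      ... | δ , σπ≡θδ = δ , λ x → trans (cong σ (sym (π-inv x))) (σπ≡θδ (π x))

  StepVia-rename : ∀ {c c′ θ Q Q₁} π → Involutive π → (∀ y → y ∈vQ Q → π y ≡ y) →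
                   (st : StepVia c c′ θ Q Q₁) → StepVia c (c′ ⟨ rename π ⟩c) (θ ∘ π) Q Q₁
  StepVia-rename {c} {c′} {θ} {Q} {Q₁} π π-inv π-fixes-Q st = record
    { pre = pre ; sel = sel ; post = post ; split = split
    ; isVariant = variant′
    ; disjoint = disjoint′
    ; isMGU = MGU-rename π π-inv (λ y y∈sel → π-fixes-Q y (in-Q (++⁺ʳ pre (here y∈sel)))) isMGU
    ; result = result′ }
    where
      open StepVia st
      ρ = rename π

      in-Q : ∀ {y} → y ∈vQ (pre ++ sel ∷ post) → y ∈vQ Q
      in-Q = subst (_ ∈vQ_) (sym split)

      variant′ : Variant (c′ ⟨ ρ ⟩c) c
      variant′ with isVariant
      ... | (ρ₁ , c′≡cρ₁) , (ρ₂ , c≡c′ρ₂) =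
        (ρ₁ ⨾ ρ , trans (cong (_⟨ ρ ⟩c) c′≡cρ₁) (⟨⟩c-⨾ c ρ₁ ρ)) ,
        (ρ ⨾ ρ₂ , trans c≡c′ρ₂ (trans (⟨⟩c-local c′ (λ y _ → cong ρ₂ (sym (π-inv y))))
                                       (sym (⟨⟩c-⨾ c′ ρ (ρ ⨾ ρ₂)))))

      disjoint′ : ∀ x → x ∈vC (c′ ⟨ ρ ⟩c) → ¬ x ∈vQ Q
      disjoint′ x x∈ x∈Q with ∈vC-⟨⟩⁻ c′ ρ x∈
      ... | y , y∈c′ , here = disjoint y y∈c′ (subst (_∈vQ Q) (trans (sym (π-fixes-Q x x∈Q)) (π-inv y)) x∈Q)

      fixed : ∀ R → (∀ {y} → y ∈vQ R → y ∈vQ Q) → R ⟨ θ ⟩q ≡ R ⟨ θ ∘ π ⟩q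
      fixed R R⊆Q = ⟨⟩q-local R (λ y y∈R → cong θ (sym (π-fixes-Q y (R⊆Q y∈R))))

      result′ : Q₁ ≡ (pre ++ body (c′ ⟨ ρ ⟩c) ++ post) ⟨ θ ∘ π ⟩q
      result′ = begin
        Q₁
          ≡⟨ result ⟩
        (pre ++ body c′ ++ post) ⟨ θ ⟩q
          ≡⟨ ⟨⟩q-++₃ pre (body c′) post θ ⟩
        pre ⟨ θ ⟩q ++ body c′ ⟨ θ ⟩q ++ post ⟨ θ ⟩q
          ≡⟨ cong₂ _++_ (fixed pre (in-Q ∘ ++⁺ˡ))
               (cong₂ _++_ body-renamed (fixed post (in-Q ∘ ++⁺ʳ pre ∘ there))) ⟩
        pre ⟨ θ ∘ π ⟩q ++ body (c′ ⟨ ρ ⟩c) ⟨ θ ∘ π ⟩q ++ post ⟨ θ ∘ π ⟩q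
          ≡⟨ sym (⟨⟩q-++₃ pre (body (c′ ⟨ ρ ⟩c)) post (θ ∘ π)) ⟩
        (pre ++ body (c′ ⟨ ρ ⟩c) ++ post) ⟨ θ ∘ π ⟩q ∎
        where
          open ≡-Reasoning
          body-renamed : body c′ ⟨ θ ⟩q ≡ body c′ ⟨ ρ ⟩q ⟨ θ ∘ π ⟩q
          body-renamed = trans (⟨⟩q-local (body c′) (λ y _ → cong θ (sym (π-inv y))))
                               (sym (⟨⟩q-⨾ (body c′) ρ (θ ∘ π)))

  StepVia-reunify : ∀ {c c′ θ θ′ Q Q₁} (st : StepVia c c′ θ Q Q₁) → MGU θ′ (StepVia.sel st) (head c′) →
                    (∀ x → x ∈vQ Q ⊎ x ∈vC c′ → θ′ x ≡ θ x) → StepVia c c′ θ′ Q Q₁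
  StepVia-reunify {c′ = c′} {θ} {θ′} {Q} st mgu θ′≡θ = record
    { pre = pre ; sel = sel ; post = post ; split = split ; isVariant = isVariant
    ; disjoint = disjoint ; isMGU = mgu
    ; result = trans result (⟨⟩q-local (pre ++ body c′ ++ post) λ x x∈ →
                               sym (θ′≡θ x (StepVia-resolvent-vars st x∈))) }
    where open StepVia st

  StepVia-++ : ∀ {c c′ θ Q Q₁} J (st : StepVia c c′ θ Q Q₁) → (∀ x → x ∈vC c′ → ¬ x ∈vQ J) →
               StepVia c c′ θ (Q ++ J) (Q₁ ++ J ⟨ θ ⟩q)
  StepVia-++ {c′ = c′} {θ} {Q} {Q₁} J st disjoint-J = record
    { pre = pre ; sel = sel ; post = post ++ J
    ; split = trans (cong (_++ J) split) (++-assoc pre (sel ∷ post) J)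
    ; isVariant = isVariant
    ; disjoint = λ x x∈c′ x∈QJ → [ disjoint x x∈c′ , disjoint-J x x∈c′ ]′ (++⁻ Q x∈QJ)
    ; isMGU = isMGU
    ; result = result′ }
    where
      open StepVia st
      result′ : Q₁ ++ J ⟨ θ ⟩q ≡ (pre ++ body c′ ++ post ++ J) ⟨ θ ⟩q
      result′ = begin
        Q₁ ++ J ⟨ θ ⟩q                          ≡⟨ cong (_++ J ⟨ θ ⟩q) result ⟩
        (pre ++ body c′ ++ post) ⟨ θ ⟩q ++ J ⟨ θ ⟩q  ≡⟨ sym (map-++ _ (pre ++ body c′ ++ post) J) ⟩
        ((pre ++ body c′ ++ post) ++ J) ⟨ θ ⟩q      ≡⟨ cong (_⟨ θ ⟩q) (++-assoc pre (body c′ ++ post) J) ⟩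
        (pre ++ (body c′ ++ post) ++ J) ⟨ θ ⟩q      ≡⟨ cong (λ R → (pre ++ R) ⟨ θ ⟩q) (++-assoc (body c′) post J) ⟩
        (pre ++ body c′ ++ post ++ J) ⟨ θ ⟩q        ∎
        where open ≡-Reasoning

  module Tame {θ : Subst} {B K : ℕ} (B≤K : B ≤ K) (θ-below : ∀ y → y < B → VarsBelow K (_∈vT θ y))
              (τ τ⁻¹ : ℕ → ℕ) (τ⁻¹-τ : ∀ y → τ⁻¹ (τ y) ≡ y) (K≤τ : ∀ y → K ≤ τ y) where

    tame : Subst
    tame = patch B θ (rename τ)

    tame-MGU : ∀ {A H} → VarsBelow B (_∈vA A) → VarsBelow B (_∈vA H) → MGU θ A H → MGU tame A H
    tame-MGU {A} {H} A<B H<B (unifies , most-general) = unifies′ , most-general′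
      where
        unifies′ : A ⟨ tame ⟩a ≡ H ⟨ tame ⟩a
        unifies′ = trans (⟨⟩a-local A (λ y y∈ → patch-< (A<B y y∈)))
                         (trans unifies (⟨⟩a-local H (λ y y∈ → sym (patch-< (H<B y y∈)))))

        most-general′ : ∀ σ → A ⟨ σ ⟩a ≡ H ⟨ σ ⟩a → ∃ λ δ → ∀ x → σ x ≡ tame x ⟨ δ ⟩
        most-general′ σ σ-unifies with most-general σ σ-unifies
        ... | δ , σ≡θδ = δ′ , factor
          where
            δ′ : Subst
            δ′ = patch K δ (σ ∘ τ⁻¹)

            factor : ∀ y → σ y ≡ tame y ⟨ δ′ ⟩
            factor y = [ below , above ]′ (<-≤-connex y B)
              where
                open ≡-Reasoning
                below : y < B → σ y ≡ tame y ⟨ δ′ ⟩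
                below y<B = begin
                  σ y          ≡⟨ σ≡θδ y ⟩
                  θ y ⟨ δ ⟩    ≡⟨ ⟨⟩-local (θ y) (λ x x∈ → sym (patch-< (θ-below y y<B x x∈))) ⟩
                  θ y ⟨ δ′ ⟩   ≡⟨ cong (_⟨ δ′ ⟩) (sym (patch-< y<B)) ⟩
                  tame y ⟨ δ′ ⟩ ∎
                above : B ≤ y → σ y ≡ tame y ⟨ δ′ ⟩
                above B≤y = begin
                  σ y             ≡⟨ cong σ (sym (τ⁻¹-τ y)) ⟩
                  σ (τ⁻¹ (τ y))   ≡⟨ sym (patch-≥ (K≤τ y)) ⟩
                  δ′ (τ y)        ≡⟨ cong (_⟨ δ′ ⟩) (sym (patch-≥ B≤y)) ⟩
                  tame y ⟨ δ′ ⟩   ∎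

    tame-avoids : ∀ {x} → K ≤ x → τ x ≡ x → ¬ x ∈vS tame
    tame-avoids {x} K≤x τx≡x (inj₁ moved) = moved (trans (patch-≥ (≤-trans B≤K K≤x)) (cong var τx≡x))
    tame-avoids {x} K≤x τx≡x (inj₂ (y , moved , x∈)) = [ below , above ]′ (<-≤-connex y B)
      where
        below : ¬ y < B
        below y<B = <⇒≱ (θ-below y y<B x (subst (x ∈vT_) (patch-< y<B) x∈)) K≤x
        above : ¬ B ≤ y
        above B≤y = moved (trans tame-y (cong var (trans τy≡τx (trans τx≡x (sym y≡x)))))
          where
            tame-y : tame y ≡ var (τ y)
            tame-y = patch-≥ B≤y
            τy≡τx : τ y ≡ τ x
            τy≡τx = trans (sym (∈vT-var (subst (x ∈vT_) tame-y x∈))) (sym τx≡x)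
            y≡x : y ≡ x
            y≡x = trans (sym (τ⁻¹-τ y)) (trans (cong τ⁻¹ τy≡τx) (τ⁻¹-τ x))

module LeftResolution (L : Language) (P : Lang.Program L) where
  open Language L
  open Lang L
  open Substitution L
  open Resolution L

  record LeftStep (Q Q′ : Query) : Set where
    field
      clause variant : Clause
      mgu : Subst
      clause∈P : clause ∈ P
      step : LeftStepVia clause variant mgu Q Q′

  record FreshStep (Q Q′ : Query) (N N′ : ℕ) : Set where
    field
      left-step : LeftStep Q Q′
      N≤N′ : N ≤ N′
      variant-fresh : ∀ x → x ∈vC LeftStep.variant left-step → N ≤ x × x < N′ × Even x
      mgu-avoids : ∀ x → N′ ≤ x → Even x → ¬ x ∈vS LeftStep.mgu left-step

  module Standardise {core Q₁ : Query} (J : Query) {N : ℕ} (s : LeftStep core Q₁)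
                     (below : VarsBelow N (_∈vQ (core ++ J))) where
    open LeftStep s
    open StepVia (proj₁ step)

    S : ℕ
    S = N ⊔ proj₁ (boundedC variant)

    variant<S : VarsBelow S (_∈vC variant)
    variant<S y y∈ = ≤-trans (proj₂ (boundedC variant) y y∈) (m≤n⊔m N _)

    open FreshSwap (_∈vC? variant) S variant<S

    N≤fresh : ∀ y → N ≤ fresh y
    N≤fresh y = ≤-trans (m≤m⊔n N _) (S≤fresh y)

    renamed-variant : Clause
    renamed-variant = variant ⟨ rename swap ⟩c

    renamed-variant-vars : ∀ {x} → x ∈vC renamed-variant → ∃ λ y → y ∈vC variant × x ≡ fresh y
    renamed-variant-vars x∈ with ∈vC-⟨⟩⁻ variant (rename swap) x∈
    ... | y , y∈ , here = y , y∈ , swap-V y∈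

    core-fixed : ∀ y → y ∈vQ core → swap y ≡ y
    core-fixed y y∈ = swap-below (≤-trans (below y (++⁺ˡ y∈)) (m≤m⊔n N _)) (λ y∈v → disjoint y y∈v y∈)

    renamed-step : StepVia clause renamed-variant (mgu ∘ swap) core Q₁
    renamed-step = StepVia-rename swap swap-involutive core-fixed (proj₁ step)

    B : ℕ
    B = 2 * (S + S)

    fresh<B : ∀ {y} → y ∈vC variant → fresh y < B
    fresh<B y∈ = *-monoʳ-< 2 (+-monoˡ-< S (variant<S _ y∈))

    K : ℕ
    K = B ⊔ proj₁ (bounded-range (mgu ∘ swap) B)

    B≤K : B ≤ K
    B≤K = m≤m⊔n B _

    renamed-mgu-below : ∀ y → y < B → VarsBelow K (_∈vT mgu (swap y))
    renamed-mgu-below y y<B x x∈ = ≤-trans (proj₂ (bounded-range (mgu ∘ swap) B) x (y , y<B , x∈)) (m≤n⊔m B _)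

    open HilbertHotel K
    open Tame B≤K renamed-mgu-below move move⁻¹ move⁻¹-move K≤move

    N≤B : N ≤ B
    N≤B = N≤fresh S

    relevant<B : VarsBelow B (λ x → x ∈vQ (core ++ J) ⊎ x ∈vC renamed-variant)
    relevant<B x (inj₁ x∈) = <-≤-trans (below x x∈) N≤B
    relevant<B x (inj₂ x∈) with renamed-variant-vars x∈
    ... | y , y∈ , refl = fresh<B y∈

    tamed-step : StepVia clause renamed-variant tame core Q₁
    tamed-step = StepVia-reunify renamed-step
                   (tame-MGU sel<B (λ y y∈ → relevant<B y (inj₂ (inj₁ y∈))) (StepVia.isMGU renamed-step))
                   (λ x x∈ → patch-< (relevant<B x (map₁ ++⁺ˡ x∈)))
      where
        sel<B : VarsBelow B (_∈vA sel)
        sel<B y y∈ = relevant<B y (inj₁ (++⁺ˡ (subst (y ∈vQ_) (sym split) (++⁺ʳ pre (here y∈)))))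

    J′ : Query
    J′ = J ⟨ tame ⟩q

    extended-step : StepVia clause renamed-variant tame (core ++ J) (Q₁ ++ J′)
    extended-step = StepVia-++ J tamed-step λ x x∈ x∈J → case renamed-variant-vars x∈ of λ
      { (y , _ , refl) → <⇒≱ (below (fresh y) (++⁺ʳ core x∈J)) (N≤fresh y) }

    fresh-step : FreshStep (core ++ J) (Q₁ ++ J′) N K
    fresh-step = record
      { left-step = record { clause = clause ; variant = renamed-variant ; mgu = tame ; clause∈P = clause∈P
                           ; step = extended-step , proj₂ step }
      ; N≤N′ = ≤-trans N≤B B≤K
      ; variant-fresh = λ x x∈ → case renamed-variant-vars x∈ of λ
          { (y , y∈ , refl) → N≤fresh y , <-≤-trans (fresh<B y∈) B≤K , (y + S , refl) }
      ; mgu-avoids = λ x K≤x even-x → tame-avoids K≤x (move-even even-x K≤x) }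

    result-below : VarsBelow K (_∈vQ (Q₁ ++ J′))
    result-below x x∈ = from-origin (StepVia-result-vars extended-step x∈)
      where
        from-origin : (∃ λ y → (y ∈vQ (core ++ J) ⊎ y ∈vC renamed-variant) × x ∈vT tame y) → x < K
        from-origin (y , y∈ , x∈tame-y) = renamed-mgu-below y y<B x (subst (x ∈vT_) (patch-< y<B) x∈tame-y)
          where y<B = relevant<B y y∈

  record FreshStepWithJunk (Q Q₁ : Query) (N : ℕ) : Set where
    field
      junk′ : Query
      bound′ : ℕ
      fresh : FreshStep Q (Q₁ ++ junk′) N bound′
      below′ : VarsBelow bound′ (_∈vQ (Q₁ ++ junk′))

  standardise : ∀ {core Q₁} J {N} → LeftStep core Q₁ → VarsBelow N (_∈vQ (core ++ J)) →
                FreshStepWithJunk (core ++ J) Q₁ N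
  standardise J s below = record { junk′ = J′ ; bound′ = K ; fresh = fresh-step ; below′ = result-below }
    where open Standardise J s below

  record Configuration (Inv : Query → Set) : Set where
    field
      query : Query
      bound : ℕ
      below : VarsBelow bound (_∈vQ query)
      invariant : Inv query
  open Configuration

  module _ (Inv : Query → Set)
           (advance : (κ : Configuration Inv) → Σ (Configuration Inv) λ κ′ →
                      FreshStep (query κ) (query κ′) (bound κ) (bound κ′)) where

    fresh-run⇒LeftLoops : (κ : Configuration Inv) → LeftLoops P (query κ)
    fresh-run⇒LeftLoops κ = record
      { qs = query ∘ run
      ; cls = LeftStep.clause ∘ step-at
      ; vs = LeftStep.variant ∘ step-at
      ; θs = LeftStep.mgu ∘ step-at
      ; start = refl
      ; inP = LeftStep.clause∈P ∘ step-at
      ; step = LeftStep.step ∘ step-at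
      ; apart = apart }
      where
        run : ℕ → Configuration Inv
        run zero = κ
        run (suc i) = proj₁ (advance (run i))

        fresh-at : ∀ i → FreshStep (query (run i)) (query (run (suc i))) (bound (run i)) (bound (run (suc i)))
        fresh-at i = proj₂ (advance (run i))

        step-at : ∀ i → LeftStep (query (run i)) (query (run (suc i)))
        step-at = FreshStep.left-step ∘ fresh-at

        bound-mono : ∀ {i j} → i ≤′ j → bound (run i) ≤ bound (run j)
        bound-mono ≤′-refl = ≤-refl
        bound-mono {j = suc j} (≤′-step i≤′j) = ≤-trans (bound-mono i≤′j) (FreshStep.N≤N′ (fresh-at j))

        apart : ∀ i → StdApart (query κ) (LeftStep.variant ∘ step-at) (LeftStep.mgu ∘ step-at) i
        apart i x x∈ with FreshStep.variant-fresh (fresh-at i) x x∈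
        ... | Nᵢ≤x , _ , even-x = not-in-query , not-in-earlier
          where
            not-in-query : ¬ x ∈vQ query κ
            not-in-query x∈κ = <⇒≱ (below κ x x∈κ) (≤-trans (bound-mono {0} {i} (≤⇒≤′ z≤n)) Nᵢ≤x)

            not-in-earlier : ∀ j → j < i →
                             ¬ x ∈vC LeftStep.variant (step-at j) × ¬ x ∈vS LeftStep.mgu (step-at j)
            not-in-earlier j j<i =
              (λ x∈vⱼ → <⇒≱ (proj₁ (proj₂ (FreshStep.variant-fresh (fresh-at j) x x∈vⱼ))) Nⱼ₊₁≤x) ,
              FreshStep.mgu-avoids (fresh-at j) x Nⱼ₊₁≤x even-x
              where
                Nⱼ₊₁≤x : bound (run (suc j)) ≤ x
                Nⱼ₊₁≤x = ≤-trans (bound-mono {suc j} {i} (≤⇒≤′ j<i)) Nᵢ≤x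

module DNLoop (L : Language) (P : Lang.Program L) (Δ : Lang.Filter L) (dn : Lang.DN L Δ P) where
  open Language L
  open Lang L
  open Substitution L
  open LeftResolution L P
  open Configuration

  _⟶⁺_ : Query → Query → Set
  _⟶⁺_ = TransClosure LeftStep

  length≡0⇒[] : ∀ {xs : Query} → length xs ≡ 0 → xs ≡ []
  length≡0⇒[] {[]} _ = refl

  lift-step : ∀ {Q Q₁ Q′} → LeftStep Q Q₁ → MoreGenQuery Δ Q′ Q →
              ∃ λ Q₁′ → LeftStep Q′ Q₁′ × MoreGenQuery Δ Q₁′ Q₁
  lift-step record { clause = c ; variant = c′ ; mgu = θ ; clause∈P = c∈P ; step = st , pre≡[] } Q′≽Q
    with dn c c∈P c′ θ _ _ st _ Q′≽Q
  ... | Q₁′ , c″ , θ′ , st′ , same-position , Q₁′≽Q₁ =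
    Q₁′ ,
    record { clause = c ; variant = c″ ; mgu = θ′ ; clause∈P = c∈P
           ; step = st′ , length≡0⇒[] (trans same-position (cong length pre≡[])) } ,
    Q₁′≽Q₁

  lift⁺ : ∀ {Q Q₂ Q′} → Q ⟶⁺ Q₂ → MoreGenQuery Δ Q′ Q → ∃ λ Q₂′ → Q′ ⟶⁺ Q₂′ × MoreGenQuery Δ Q₂′ Q₂
  lift⁺ [ s ] Q′≽Q with lift-step s Q′≽Q
  ... | Q₁′ , s′ , Q₁′≽Q₁ = Q₁′ , [ s′ ] , Q₁′≽Q₁
  lift⁺ (s ∷ d) Q′≽Q with lift-step s Q′≽Q
  ... | Q₁′ , s′ , Q₁′≽Q₁ with lift⁺ d Q₁′≽Q₁
  ...   | Q₂′ , d′ , Q₂′≽Q₂ = Q₂′ , s′ ∷ d′ , Q₂′≽Q₂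

  prefix⇒⁺ : ∀ {Q Q′} → Q ⇒+[ P ] Q′ → Q ⟶⁺ Q′
  prefix⇒⁺ {Q} {Q′} (suc n , _ , d) = subst (_⟶⁺ Q′) start (from 0 n refl)
    where
      open LeftPrefix d
      step-at : ∀ i → i < suc n → LeftStep (qs i) (qs (suc i))
      step-at i i<1+n = record { clause = cls i ; variant = vs i ; mgu = θs i
                               ; clause∈P = inP i i<1+n ; step = step i i<1+n }
      from : ∀ i k → i + suc k ≡ suc n → qs i ⟶⁺ Q′
      from i zero i+1≡1+n = [ subst (LeftStep (qs i)) (trans (cong qs (trans (+-comm 1 i) i+1≡1+n)) finish)
                                    (step-at i (subst (i <_) i+1≡1+n (m<m+n i z<s))) ]
      from i (suc k) i+2+k≡1+n = step-at i (subst (i <_) i+2+k≡1+n (m<m+n i z<s))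
                               ∷ from (suc i) k (trans (sym (+-suc i (suc k))) i+2+k≡1+n)

  record Cycle (C : Atom) : Set where
    field
      next : Atom
      residue : Query
      derivation : (C ∷ []) ⟶⁺ (next ∷ residue)
      more-general : MoreGenAtom Δ next C

  lift-cycle : ∀ {C} (cy : Cycle C) → Cycle (Cycle.next cy)
  lift-cycle record { derivation = d ; more-general = η , next≽C } with lift⁺ d (η , next≽C ∷ [])
  ... | next′ ∷ residue′ , d′ , η′ , next′≽next ∷ _ = record
    { next = next′ ; residue = residue′ ; derivation = d′ ; more-general = η′ , next′≽next }

  record Pending (Q : Query) : Set where
    field
      core junk : Query
      split : Q ≡ core ++ junk
      target : Atom
      rest : Query
      derivation : core ⟶⁺ (target ∷ rest)
      cycle : Cycle target

  arrive : ∀ {C} → Cycle C → ∀ R → Pending (C ∷ R)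
  arrive {C} cy R = record
    { core = C ∷ [] ; junk = R ; split = refl ; target = Cycle.next cy ; rest = Cycle.residue cy
    ; derivation = Cycle.derivation cy ; cycle = lift-cycle cy }

  advance : (κ : Configuration Pending) → Σ (Configuration Pending) λ κ′ →
            FreshStep (query κ) (query κ′) (bound κ) (bound κ′)
  advance record { below = below
                 ; invariant = record { junk = J ; split = refl ; derivation = [ s ] ; cycle = cy } } =
    record { below = below′ ; invariant = arrive cy _ } , fresh
    where open FreshStepWithJunk (standardise J s below)
  advance record { below = below
                 ; invariant = record { junk = J ; split = refl ; derivation = s ∷ d ; cycle = cy } } =
    record { below = below′ ; invariant = record
      { core = _ ; junk = junk′ ; split = refl ; target = _ ; rest = _ ; derivation = d ; cycle = cy } } , fresh
    where open FreshStepWithJunk (standardise J s below)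

  Pending⇒LeftLoops : ∀ {Q} → Pending Q → LeftLoops P Q
  Pending⇒LeftLoops {Q} p = fresh-run⇒LeftLoops Pending advance
    record { query = Q ; bound = proj₁ (boundedQ Q) ; below = proj₂ (boundedQ Q) ; invariant = p }

  initial : ∀ {A B₁ 𝐁₁} → (A ∷ []) ⇒*[ P ] (B₁ ∷ 𝐁₁) → Cycle B₁ → Pending (A ∷ [])
  initial (zero , d) cy = subst Pending (trans (sym finish) start) (arrive cy _)
    where open LeftPrefix d
  initial (suc n , d) cy = record
    { core = _ ; junk = [] ; split = refl ; target = _ ; rest = _
    ; derivation = prefix⇒⁺ (suc n , s≤s z≤n , d) ; cycle = cy }

corollary2 : (L : Language) → let open Lang L in
    (P : Program) (Δ : Filter) → DN Δ P →
    (A B₁ B₂ : Atom) (𝐁₁ 𝐁₂ : Query) →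
    (A ∷ []) ⇒*[ P ] (B₁ ∷ 𝐁₁) →
    (B₁ ∷ []) ⇒+[ P ] (B₂ ∷ 𝐁₂) →
    MoreGenAtom Δ B₂ B₁ →
    LeftLoops P (A ∷ [])
corollary2 L P Δ dn A B₁ B₂ 𝐁₁ 𝐁₂ A⇒*B₁𝐁₁ B₁⇒⁺B₂𝐁₂ B₂≽B₁ =
  Pending⇒LeftLoops (initial A⇒*B₁𝐁₁ cycle)
  where
    open DNLoop L P Δ dn
    cycle : Cycle B₁
    cycle = record { next = B₂ ; residue = 𝐁₂ ; derivation = prefix⇒⁺ B₁⇒⁺B₂𝐁₂ ; more-general = B₂≽B₁ }
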